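{- Let $R$ be a commutative ring with unity and let \[S=\{\,x_0^6-2x_1^3+3x_2^2 \pmod{6R} \;:\; x_0,x_1,x_2\in R\,\}\subseteq R/6R.\] Then a matrix $M\in M_2(R)$ is a sum of sixth powers of matrices in $M_2(R)$ (i.e., $M=\sum_{i=1}^r M_i^6$ for some $r\ge1$ and $M_i\in M_2(R)$) if and only if $\operatorname{Tr} M \pmod{6R}\in S$.
   Context: $\operatorname{Tr}$ denotes the trace; $x\pmod{6R}$ denotes the image of $x\in R$ in $R/6R$. -}

module Defs where

open import Level using (_⊔_)
open import Data.Nat using (ℕ; zero; suc)
open import Data.Fin using (Fin; zero; suc)
open import Data.Product using (Σ; _×_; ∃-syntax)
open import Algebra.Bundles using (CommutativeRing)

module _ {c ℓ} (R : CommutativeRing c ℓ) where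
  open CommutativeRing R using (Carrier; _≈_; _+_; _*_; _-_; 0#; 1#)

  Mat₂ : Set c
  Mat₂ = Fin 2 → Fin 2 → Carrier

  _≈M_ : Mat₂ → Mat₂ → Set ℓ
  A ≈M B = ∀ i j → A i j ≈ B i j

  _+M_ : Mat₂ → Mat₂ → Mat₂
  (A +M B) i j = A i j + B i j

  _*M_ : Mat₂ → Mat₂ → Mat₂
  (A *M B) i j = A i zero * B zero j + A i (suc zero) * B (suc zero) j

  idM : Mat₂
  idM zero zero = 1#
  idM zero (suc zero) = 0#
  idM (suc zero) zero = 0#
  idM (suc zero) (suc zero) = 1#

  _^M_ : Mat₂ → ℕ → Mat₂
  A ^M zero = idM
  A ^M suc n = A *M (A ^M n)

  tr : Mat₂ → Carrier
  tr A = A zero zero + A (suc zero) (suc zero)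

  -- r ≥ 1 summands: M₀^6 + ... + M_r^6 (indexed by Fin (suc r))
  sumM : (r : ℕ) → (Fin (suc r) → Mat₂) → Mat₂
  sumM zero f = f zero
  sumM (suc r) f = f zero +M sumM r (λ i → f (suc i))

  IsSumOfSixthPowers : Mat₂ → Set (c ⊔ ℓ)
  IsSumOfSixthPowers M = Σ ℕ λ r → Σ (Fin (suc r) → Mat₂) λ f → (M ≈M sumM r (λ i → f i ^M 6))

  nat : ℕ → Carrier
  nat zero = 0#
  nat (suc n) = 1# + nat n

  _^R_ : Carrier → ℕ → Carrier
  a ^R zero = 1#
  a ^R suc n = a * (a ^R n)

  -- t mod 6R lies in S = { x0^6 - 2 x1^3 + 3 x2^2 mod 6R }
  TraceInS : Carrier → Set (c ⊔ ℓ)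
  TraceInS t = ∃[ x₀ ] ∃[ x₁ ] ∃[ x₂ ] ∃[ y ]
    (t ≈ ((x₀ ^R 6) - nat 2 * (x₁ ^R 3) + nat 3 * (x₂ ^R 2)) + nat 6 * y)

module Submission where

-- If A has trace t and determinant d then tr A⁶ = t⁶ - 6t⁴d + 9t²d² - 2d³, which is
-- t⁶ - 2d³ + 3(td)² modulo 6; and modulo 6 every x₀⁶ - 2x₁³ + 3x₂² can be rewritten
-- as -2u³ + 3v², a form closed under addition. So traces of sums of sixth powers lie in S.
-- Conversely, companion matrices realise t⁶ - 6t⁴d + 9t²d² - 2d³ for all t and d, and
-- sums of these reach all of x₀⁶ - 2x₁³ + 3x₂² + 6R. If tr M is such a value, realised
-- by a sum B of sixth powers, then M - B is traceless, and every traceless matrix is an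
-- explicit sum of six sixth powers.

open import Algebra.Bundles using (CommutativeRing)
import Algebra.Properties.CommutativeSemigroup as CommutativeSemigroupProperties
import Algebra.Properties.Ring as RingProperties
import Algebra.Properties.Semiring.Mult.TCOptimised as SemiringMultiplication
open import Algebra.Solver.Ring.AlmostCommutativeRing
  using (fromCommutativeRing; _-Raw-AlmostCommutative⟶_)
open import Data.Fin using (Fin; zero; suc)
open import Data.Integer as ℤ using (ℤ; +_; -[1+_]; _⊖_; _◃_; sign; ∣_∣)
import Data.Integer.Properties as ℤᵖ
open import Data.List using (List; []; _∷_; _++_; length)
open import Data.Maybe using (Maybe; just; nothing)
open import Data.Nat as ℕ using (ℕ; zero; suc)
import Data.Nat.Properties as ℕᵖ
open import Data.Product using (Σ; _×_; _,_; ∃-syntax)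
open import Data.Sign as Sign using (Sign)
open import Function.Bundles using (_⇔_; mk⇔)
open import Level using (_⊔_)
import Relation.Binary.PropositionalEquality as ≡
open import Relation.Nullary using (yes; no)

open import Defs

-- Multiplication by naturals is taken from the
-- type-checking-optimised module so that fromℤ (+ 1) reduces to 1# and evaluated
-- polynomials match Defs.nat on the nose.
module IntegerCoefficients {c ℓ} (R : CommutativeRing c ℓ) where
  open CommutativeRing R
  open RingProperties ring using (-0#≈0#; -‿involutive; -‿+-comm; -‿distribˡ-*; -‿distribʳ-*)
  open CommutativeSemigroupProperties +-commutativeSemigroup using (interchange)
  open SemiringMultiplication semiring using (×-homo-+; ×1-homo-*) renaming (_×_ to _·_)
  open import Relation.Binary.Reasoning.Setoid setoid

  fromℕ : ℕ → Carrier
  fromℕ n = n · 1#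

  fromℕ-suc : ∀ n → fromℕ (suc n) ≈ 1# + fromℕ n
  fromℕ-suc n = ×-homo-+ 1# 1 n

  fromℤ : ℤ → Carrier
  fromℤ (+ n) = fromℕ n
  fromℤ -[1+ n ] = - fromℕ (suc n)

  fromℤ-⊖ : ∀ m n → fromℤ (m ⊖ n) ≈ fromℕ m - fromℕ n
  fromℤ-⊖ zero zero = sym (-‿inverseʳ 0#)
  fromℤ-⊖ zero (suc n) = sym (+-identityˡ _)
  fromℤ-⊖ (suc m) zero = sym (trans (+-congˡ -0#≈0#) (+-identityʳ _))
  fromℤ-⊖ (suc m) (suc n) = begin
    fromℤ (suc m ⊖ suc n)              ≡⟨ ≡.cong fromℤ (ℤᵖ.[1+m]⊖[1+n]≡m⊖n m n) ⟩
    fromℤ (m ⊖ n)                      ≈⟨ fromℤ-⊖ m n ⟩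
    fromℕ m - fromℕ n                  ≈⟨ +-identityˡ _ ⟨
    0# + (fromℕ m - fromℕ n)           ≈⟨ +-congʳ (-‿inverseʳ 1#) ⟨
    (1# - 1#) + (fromℕ m - fromℕ n)    ≈⟨ interchange 1# (- 1#) (fromℕ m) (- fromℕ n) ⟩
    (1# + fromℕ m) + (- 1# - fromℕ n)  ≈⟨ +-congˡ (-‿+-comm 1# (fromℕ n)) ⟩
    (1# + fromℕ m) - (1# + fromℕ n)    ≈⟨ +-cong (fromℕ-suc m) (-‿cong (fromℕ-suc n)) ⟨
    fromℕ (suc m) - fromℕ (suc n)      ∎

  fromℤ-+ : ∀ i j → fromℤ (i ℤ.+ j) ≈ fromℤ i + fromℤ j
  fromℤ-+ -[1+ m ] -[1+ n ] = begin
    - fromℕ (suc (suc (m ℕ.+ n)))      ≡⟨ ≡.cong (λ k → - fromℕ (suc k)) (ℕᵖ.+-suc m n) ⟨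
    - fromℕ (suc m ℕ.+ suc n)          ≈⟨ -‿cong (×-homo-+ 1# (suc m) (suc n)) ⟩
    - (fromℕ (suc m) + fromℕ (suc n))  ≈⟨ -‿+-comm _ _ ⟨
    - fromℕ (suc m) - fromℕ (suc n)    ∎
  fromℤ-+ -[1+ m ] (+ n) = trans (fromℤ-⊖ n (suc m)) (+-comm _ _)
  fromℤ-+ (+ m) -[1+ n ] = fromℤ-⊖ m (suc n)
  fromℤ-+ (+ m) (+ n) = ×-homo-+ 1# m n

  fromℤ-neg : ∀ i → fromℤ (ℤ.- i) ≈ - fromℤ i
  fromℤ-neg (+ zero) = sym -0#≈0#
  fromℤ-neg (+ suc n) = refl
  fromℤ-neg -[1+ n ] = sym (-‿involutive _)

  signed : Sign → Carrier → Carrier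
  signed Sign.+ x = x
  signed Sign.- x = - x

  signed-cong : ∀ s {x y} → x ≈ y → signed s x ≈ signed s y
  signed-cong Sign.+ x≈y = x≈y
  signed-cong Sign.- x≈y = -‿cong x≈y

  signed-* : ∀ s t x y → signed (s Sign.* t) (x * y) ≈ signed s x * signed t y
  signed-* Sign.+ Sign.+ x y = refl
  signed-* Sign.+ Sign.- x y = -‿distribʳ-* x y
  signed-* Sign.- Sign.+ x y = -‿distribˡ-* x y
  signed-* Sign.- Sign.- x y = begin
    x * y          ≈⟨ -‿involutive _ ⟨
    - - (x * y)    ≈⟨ -‿cong (-‿distribˡ-* x y) ⟩
    - (- x * y)    ≈⟨ -‿distribʳ-* (- x) y ⟩
    - x * - y      ∎

  fromℤ-◃ : ∀ s n → fromℤ (s ◃ n) ≈ signed s (fromℕ n)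
  fromℤ-◃ Sign.+ zero = refl
  fromℤ-◃ Sign.- zero = sym -0#≈0#
  fromℤ-◃ Sign.+ (suc n) = refl
  fromℤ-◃ Sign.- (suc n) = refl

  fromℤ-signed : ∀ i → fromℤ i ≈ signed (sign i) (fromℕ ∣ i ∣)
  fromℤ-signed (+ n) = refl
  fromℤ-signed -[1+ n ] = refl

  fromℤ-* : ∀ i j → fromℤ (i ℤ.* j) ≈ fromℤ i * fromℤ j
  fromℤ-* i j = begin
    fromℤ (i ℤ.* j)                                   ≈⟨ fromℤ-◃ (sign i Sign.* sign j) (∣ i ∣ ℕ.* ∣ j ∣) ⟩
    signed (sign i Sign.* sign j) (fromℕ (∣ i ∣ ℕ.* ∣ j ∣))
      ≈⟨ signed-cong (sign i Sign.* sign j) (×1-homo-* ∣ i ∣ ∣ j ∣) ⟩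
    signed (sign i Sign.* sign j) (fromℕ ∣ i ∣ * fromℕ ∣ j ∣)
      ≈⟨ signed-* (sign i) (sign j) _ _ ⟩
    signed (sign i) (fromℕ ∣ i ∣) * signed (sign j) (fromℕ ∣ j ∣)
      ≈⟨ *-cong (fromℤ-signed i) (fromℤ-signed j) ⟨
    fromℤ i * fromℤ j                                 ∎

  fromℤ-homomorphism : ℤ.+-*-rawRing -Raw-AlmostCommutative⟶ fromCommutativeRing R
  fromℤ-homomorphism = record
    { ⟦_⟧    = fromℤ
    ; +-homo = fromℤ-+
    ; *-homo = fromℤ-*
    ; -‿homo = fromℤ-neg
    ; 0-homo = refl
    ; 1-homo = refl
    }

  fromℤ-≟ : ∀ i j → Maybe (fromℤ i ≈ fromℤ j)
  fromℤ-≟ i j with i ℤ.≟ j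
  ... | yes ≡.refl = just refl
  ... | no _ = nothing

  open import Algebra.Solver.Ring ℤ.+-*-rawRing (fromCommutativeRing R) fromℤ-homomorphism fromℤ-≟
    public

module SixthPowers {r ℓ} (R : CommutativeRing r ℓ) where
  open CommutativeRing R hiding (zero)
  open RingProperties ring using (+-inverseʳ-unique; -‿+-comm)
  open CommutativeSemigroupProperties +-commutativeSemigroup using (interchange)
  open IntegerCoefficients R using (Polynomial; con; solve; _:=_; _:+_; _:*_; _:-_; :-_)
  open import Relation.Binary.Reasoning.Setoid setoid

  Matrix : Set r
  Matrix = Mat₂ R

  infix 4 _≋_
  infixl 6 _⊕_
  infixl 8 _^ᴹ_
  infixr 9 _^_

  _≋_ : Matrix → Matrix → Set ℓ
  _≋_ = _≈M_ R

  _⊕_ : Matrix → Matrix → Matrix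
  _⊕_ = _+M_ R

  _^ᴹ_ : Matrix → ℕ → Matrix
  _^ᴹ_ = _^M_ R

  _^_ : Carrier → ℕ → Carrier
  _^_ = _^R_ R

  n# : ℕ → Carrier
  n# = nat R

  mat : Carrier → Carrier → Carrier → Carrier → Matrix
  mat a b c d zero zero = a
  mat a b c d zero (suc zero) = b
  mat a b c d (suc zero) zero = c
  mat a b c d (suc zero) (suc zero) = d

  det : Matrix → Carrier
  det A = A zero zero * A (suc zero) (suc zero) - A zero (suc zero) * A (suc zero) zero

  sixthPowerTrace : Carrier → Carrier → Carrier
  sixthPowerTrace t d = ((t ^ 6 - n# 6 * (t ^ 4 * d)) + n# 9 * (t ^ 2 * d ^ 2)) - n# 2 * d ^ 3

  -- TraceInS R t unfolds to ∃ x₀ x₁ x₂ y, t ≈ sForm x₀ x₁ x₂ y.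
  sForm : Carrier → Carrier → Carrier → Carrier → Carrier
  sForm x₀ x₁ x₂ y = ((x₀ ^ 6) - n# 2 * (x₁ ^ 3) + n# 3 * (x₂ ^ 2)) + n# 6 * y

  -- Syntactic copies of the operations above, whose evaluation is definitionally the
  -- original: this lets the ring solver prove matrix identities entry by entry.
  module Syntax {n : ℕ} where
    PolyMatrix : Set
    PolyMatrix = Fin 2 → Fin 2 → Polynomial n

    infixl 6 _⊕ᴾ_
    infixl 8 _^ᴹᴾ_
    infixr 9 _^ᴾ_

    0ᴾ 1ᴾ : Polynomial n
    0ᴾ = con (+ 0)
    1ᴾ = con (+ 1)

    natᴾ : ℕ → Polynomial n
    natᴾ zero = 0ᴾ
    natᴾ (suc k) = 1ᴾ :+ natᴾ k

    _^ᴾ_ : Polynomial n → ℕ → Polynomial n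
    p ^ᴾ zero = 1ᴾ
    p ^ᴾ suc k = p :* (p ^ᴾ k)

    matᴾ : Polynomial n → Polynomial n → Polynomial n → Polynomial n → PolyMatrix
    matᴾ a b c d zero zero = a
    matᴾ a b c d zero (suc zero) = b
    matᴾ a b c d (suc zero) zero = c
    matᴾ a b c d (suc zero) (suc zero) = d

    _⊕ᴾ_ : PolyMatrix → PolyMatrix → PolyMatrix
    (A ⊕ᴾ B) i j = A i j :+ B i j

    _⊛ᴾ_ : PolyMatrix → PolyMatrix → PolyMatrix
    (A ⊛ᴾ B) i j = A i zero :* B zero j :+ A i (suc zero) :* B (suc zero) j

    _^ᴹᴾ_ : PolyMatrix → ℕ → PolyMatrix
    A ^ᴹᴾ zero = matᴾ 1ᴾ 0ᴾ 0ᴾ 1ᴾ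
    A ^ᴹᴾ suc k = A ⊛ᴾ (A ^ᴹᴾ k)

    trᴾ : PolyMatrix → Polynomial n
    trᴾ A = A zero zero :+ A (suc zero) (suc zero)

    sixthPowerTraceᴾ : Polynomial n → Polynomial n → Polynomial n
    sixthPowerTraceᴾ t d =
      ((t ^ᴾ 6 :- natᴾ 6 :* (t ^ᴾ 4 :* d)) :+ natᴾ 9 :* (t ^ᴾ 2 :* d ^ᴾ 2)) :- natᴾ 2 :* d ^ᴾ 3

    sFormᴾ : Polynomial n → Polynomial n → Polynomial n → Polynomial n → Polynomial n
    sFormᴾ x₀ x₁ x₂ y = ((x₀ ^ᴾ 6) :- natᴾ 2 :* (x₁ ^ᴾ 3) :+ natᴾ 3 :* (x₂ ^ᴾ 2)) :+ natᴾ 6 :* y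

  open Syntax

  tr-^6 : ∀ A → tr R (A ^ᴹ 6) ≈ sixthPowerTrace (tr R A) (det A)
  tr-^6 A = solve 4
    (λ a b c d → trᴾ (matᴾ a b c d ^ᴹᴾ 6) := sixthPowerTraceᴾ (a :+ d) (a :* d :- b :* c))
    refl (A zero zero) (A zero (suc zero)) (A (suc zero) zero) (A (suc zero) (suc zero))

  traceInS-cong : ∀ {s t} → s ≈ t → TraceInS R t → TraceInS R s
  traceInS-cong s≈t (x₀ , x₁ , x₂ , y , t≈) = x₀ , x₁ , x₂ , y , trans s≈t t≈

  sixthPowerTrace-inS : ∀ t d → TraceInS R (sixthPowerTrace t d)
  sixthPowerTrace-inS t d = t , d , t * d , t ^ 2 * d ^ 2 - t ^ 4 * d ,
    solve 2 (λ t d → sixthPowerTraceᴾ t d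
                   := sFormᴾ t d (t :* d) (t ^ᴾ 2 :* d ^ᴾ 2 :- t ^ᴾ 4 :* d)) refl t d

  traceInS-^6 : ∀ A → TraceInS R (tr R (A ^ᴹ 6))
  traceInS-^6 A = traceInS-cong (tr-^6 A) (sixthPowerTrace-inS (tr R A) (det A))

  -- x₀⁶ = -2(x₀²)³ + 3(x₀³)² modulo 6, so x₀ can be absorbed into x₁ and x₂.
  traceInS-without-x₀ : ∀ {t} → TraceInS R t → ∃[ u ] ∃[ v ] ∃[ y ] t ≈ sForm 0# u v y
  traceInS-without-x₀ (x₀ , x₁ , x₂ , y , t≈) =
    x₁ + x₀ ^ 2 , x₂ + x₀ ^ 3 , y + x₁ * x₀ ^ 2 * (x₁ + x₀ ^ 2) - x₂ * x₀ ^ 3 ,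
    trans t≈ (solve 4 (λ x₀ x₁ x₂ y →
      sFormᴾ x₀ x₁ x₂ y := sFormᴾ 0ᴾ (x₁ :+ x₀ ^ᴾ 2) (x₂ :+ x₀ ^ᴾ 3)
                                 (y :+ x₁ :* x₀ ^ᴾ 2 :* (x₁ :+ x₀ ^ᴾ 2) :- x₂ :* x₀ ^ᴾ 3))
      refl x₀ x₁ x₂ y)

  -- -2u³ and 3v² are additive modulo 6: (u + u′)³ - u³ - u′³ = 3uu′(u + u′)
  -- and (v + v′)² - v² - v′² = 2vv′.
  sForm-+ : ∀ u v y u′ v′ y′ → sForm 0# u v y + sForm 0# u′ v′ y′
                             ≈ sForm 0# (u + u′) (v + v′) (y + y′ + u * u′ * (u + u′) - v * v′)
  sForm-+ u v y u′ v′ y′ = solve 6 (λ u v y u′ v′ y′ →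
    sFormᴾ 0ᴾ u v y :+ sFormᴾ 0ᴾ u′ v′ y′
      := sFormᴾ 0ᴾ (u :+ u′) (v :+ v′) (y :+ y′ :+ u :* u′ :* (u :+ u′) :- v :* v′)) refl u v y u′ v′ y′

  traceInS-+ : ∀ {s t} → TraceInS R s → TraceInS R t → TraceInS R (s + t)
  traceInS-+ s∈ t∈ =
    let u , v , y , s≈ = traceInS-without-x₀ s∈
        u′ , v′ , y′ , t≈ = traceInS-without-x₀ t∈
    in 0# , u + u′ , v + v′ , y + y′ + u * u′ * (u + u′) - v * v′ ,
    trans (+-cong s≈ t≈) (sForm-+ u v y u′ v′ y′)

  tr-⊕ : ∀ A B → tr R (A ⊕ B) ≈ tr R A + tr R B
  tr-⊕ A B = interchange (A zero zero) (B zero zero) (A (suc zero) (suc zero)) (B (suc zero) (suc zero))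

  traceInS-sumM : ∀ r (f : Fin (suc r) → Matrix) → TraceInS R (tr R (sumM R r (λ i → f i ^ᴹ 6)))
  traceInS-sumM zero f = traceInS-^6 (f zero)
  traceInS-sumM (suc r) f =
    traceInS-cong (tr-⊕ (f zero ^ᴹ 6) (sumM R r (λ i → f (suc i) ^ᴹ 6)))
      (traceInS-+ (traceInS-^6 (f zero)) (traceInS-sumM r (λ i → f (suc i))))

  0ᴹ : Matrix
  0ᴹ i j = 0#

  ≋-refl : ∀ {A} → A ≋ A
  ≋-refl i j = refl

  ≋-sym : ∀ {A B} → A ≋ B → B ≋ A
  ≋-sym A≋B i j = sym (A≋B i j)

  ≋-trans : ∀ {A B C} → A ≋ B → B ≋ C → A ≋ C
  ≋-trans A≋B B≋C i j = trans (A≋B i j) (B≋C i j)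

  ⊕-cong : ∀ {A B C D} → A ≋ B → C ≋ D → A ⊕ C ≋ B ⊕ D
  ⊕-cong A≋B C≋D i j = +-cong (A≋B i j) (C≋D i j)

  sumSixthPowers : List Matrix → Matrix
  sumSixthPowers [] = 0ᴹ
  sumSixthPowers (A ∷ As) = A ^ᴹ 6 ⊕ sumSixthPowers As

  sumSixthPowers-++ : ∀ As Bs → sumSixthPowers (As ++ Bs) ≋ sumSixthPowers As ⊕ sumSixthPowers Bs
  sumSixthPowers-++ [] Bs i j = sym (+-identityˡ _)
  sumSixthPowers-++ (A ∷ As) Bs i j =
    trans (+-congˡ (sumSixthPowers-++ As Bs i j)) (sym (+-assoc _ _ _))

  SumOfSixthPowers : Matrix → Set (r ⊔ ℓ)
  SumOfSixthPowers M = Σ (List Matrix) λ As → M ≋ sumSixthPowers As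

  sumOfSixthPowers-cong : ∀ {A B} → A ≋ B → SumOfSixthPowers B → SumOfSixthPowers A
  sumOfSixthPowers-cong A≋B (As , B≋) = As , ≋-trans A≋B B≋

  sumOfSixthPowers-+ : ∀ {A B} → SumOfSixthPowers A → SumOfSixthPowers B → SumOfSixthPowers (A ⊕ B)
  sumOfSixthPowers-+ (As , A≋) (Bs , B≋) =
    As ++ Bs , ≋-trans (⊕-cong A≋ B≋) (≋-sym (sumSixthPowers-++ As Bs))

  -- The summands: four idempotents (trace 1, determinant 0, hence equal to their
  -- sixth powers) adding up to C + 2I, and twice a square root of -I.
  traceless-sumOfSixthPowers : ∀ C → tr R C ≈ 0# → SumOfSixthPowers C
  traceless-sumOfSixthPowers C trC≈0 = summands a b c , C≋
    where
    a = C zero zero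
    b = C zero (suc zero)
    c = C (suc zero) zero

    summands : Carrier → Carrier → Carrier → List Matrix
    summands a b c = mat (a + 1#) a (- a - 1#) (- a) ∷ mat 1# (b - a) 0# 0# ∷ mat 0# 0# (c + a + 1#) 1#
                   ∷ mat 0# 0# 0# 1# ∷ mat 0# 1# (- 1#) 0# ∷ mat 0# 1# (- 1#) 0# ∷ []

    summandsᴾ : ∀ {n} → Polynomial n → Polynomial n → Polynomial n → PolyMatrix
    summandsᴾ a b c =
      (matᴾ (a :+ 1ᴾ) a (:- a :- 1ᴾ) (:- a) ^ᴹᴾ 6) ⊕ᴾ ((matᴾ 1ᴾ (b :- a) 0ᴾ 0ᴾ ^ᴹᴾ 6)
      ⊕ᴾ ((matᴾ 0ᴾ 0ᴾ (c :+ a :+ 1ᴾ) 1ᴾ ^ᴹᴾ 6) ⊕ᴾ ((matᴾ 0ᴾ 0ᴾ 0ᴾ 1ᴾ ^ᴹᴾ 6)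
      ⊕ᴾ ((matᴾ 0ᴾ 1ᴾ (:- 1ᴾ) 0ᴾ ^ᴹᴾ 6) ⊕ᴾ ((matᴾ 0ᴾ 1ᴾ (:- 1ᴾ) 0ᴾ ^ᴹᴾ 6) ⊕ᴾ matᴾ 0ᴾ 0ᴾ 0ᴾ 0ᴾ)))))

    d≈-a : C (suc zero) (suc zero) ≈ - a
    d≈-a = +-inverseʳ-unique a (C (suc zero) (suc zero)) trC≈0

    C≋ : C ≋ sumSixthPowers (summands a b c)
    C≋ zero zero = sym (solve 3 (λ a b c → summandsᴾ a b c zero zero := a) refl a b c)
    C≋ zero (suc zero) = sym (solve 3 (λ a b c → summandsᴾ a b c zero (suc zero) := b) refl a b c)
    C≋ (suc zero) zero = sym (solve 3 (λ a b c → summandsᴾ a b c (suc zero) zero := c) refl a b c)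
    C≋ (suc zero) (suc zero) =
      trans d≈-a (sym (solve 3 (λ a b c → summandsᴾ a b c (suc zero) (suc zero) := :- a) refl a b c))

  0ᴹ-^suc : ∀ n → 0ᴹ ^ᴹ suc n ≋ 0ᴹ
  0ᴹ-^suc n i j = trans (+-cong (zeroˡ _) (zeroˡ _)) (+-identityʳ 0#)

  -- IsSumOfSixthPowers asks for at least one summand, so the list is padded with 0ᴹ.
  padded : (As : List Matrix) → Fin (suc (length As)) → Matrix
  padded [] zero = 0ᴹ
  padded (A ∷ As) zero = A
  padded (A ∷ As) (suc i) = padded As i

  sumM-padded : ∀ As → sumM R (length As) (λ i → padded As i ^ᴹ 6) ≋ sumSixthPowers As
  sumM-padded [] = 0ᴹ-^suc 5
  sumM-padded (A ∷ As) = ⊕-cong ≋-refl (sumM-padded As)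

  sumOfSixthPowers⇒isSumOfSixthPowers : ∀ {M} → SumOfSixthPowers M → IsSumOfSixthPowers R M
  sumOfSixthPowers⇒isSumOfSixthPowers (As , M≋) = length As , padded As , ≋-trans M≋ (≋-sym (sumM-padded As))

  Realised : Carrier → Set (r ⊔ ℓ)
  Realised τ = Σ Matrix λ B → SumOfSixthPowers B × tr R B ≈ τ

  realised-cong : ∀ {s t} → s ≈ t → Realised s → Realised t
  realised-cong s≈t (B , B∈ , trB≈s) = B , B∈ , trans trB≈s s≈t

  realised-+ : ∀ {s t} → Realised s → Realised t → Realised (s + t)
  realised-+ (A , A∈ , trA≈s) (B , B∈ , trB≈t) =
    A ⊕ B , sumOfSixthPowers-+ A∈ B∈ , trans (tr-⊕ A B) (+-cong trA≈s trB≈t)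

  -- The companion matrix of X² - tX + d has trace t and determinant d.
  realised-sixthPowerTrace : ∀ t d → Realised (sixthPowerTrace t d)
  realised-sixthPowerTrace t d = A ^ᴹ 6 , (A ∷ [] , λ i j → sym (+-identityʳ _)) ,
    solve 2 (λ t d → trᴾ (matᴾ t d (:- 1ᴾ) 0ᴾ ^ᴹᴾ 6) := sixthPowerTraceᴾ t d) refl t d
    where
    A = mat t d (- 1#) 0#

  -- sixthPowerTrace 0 d = -2d³ and sixthPowerTrace 1 d = (1 - 3d)² - 2d³:
  -- the cubes cancel in the combinations below.
  realised-6[d²+d] : ∀ d → Realised (n# 6 * (d * d + d))
  realised-6[d²+d] d = realised-cong
    (solve 1 (λ d → sixthPowerTraceᴾ 0ᴾ (:- (d :+ 1ᴾ)) :+ (sixthPowerTraceᴾ 0ᴾ d :+ sixthPowerTraceᴾ 0ᴾ 1ᴾ)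
                    := natᴾ 6 :* (d :* d :+ d)) refl d)
    (realised-+ (realised-sixthPowerTrace 0# (- (d + 1#)))
      (realised-+ (realised-sixthPowerTrace 0# d) (realised-sixthPowerTrace 0# 1#)))

  realised-9d²-6d : ∀ d → Realised (n# 9 * (d * d) - n# 6 * d)
  realised-9d²-6d d = realised-cong
    (solve 1 (λ d → sixthPowerTraceᴾ 1ᴾ d :+ (sixthPowerTraceᴾ 0ᴾ (:- d)
                      :+ (sixthPowerTraceᴾ 0ᴾ 1ᴾ :+ sixthPowerTraceᴾ 1ᴾ 0ᴾ))
                    := natᴾ 9 :* (d :* d) :- natᴾ 6 :* d) refl d)
    (realised-+ (realised-sixthPowerTrace 1# d) (realised-+ (realised-sixthPowerTrace 0# (- d))
      (realised-+ (realised-sixthPowerTrace 0# 1#) (realised-sixthPowerTrace 1# 0#))))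

  realised--12e : ∀ e → Realised (- (n# 12 * e))
  realised--12e e = realised-cong
    (solve 1 (λ e → sixthPowerTraceᴾ 0ᴾ (e :+ 1ᴾ) :+ (sixthPowerTraceᴾ 0ᴾ (e :- 1ᴾ)
                      :+ (sixthPowerTraceᴾ 0ᴾ (:- e) :+ sixthPowerTraceᴾ 0ᴾ (:- e)))
                    := :- (natᴾ 12 :* e)) refl e)
    (realised-+ (realised-sixthPowerTrace 0# (e + 1#)) (realised-+ (realised-sixthPowerTrace 0# (e - 1#))
      (realised-+ (realised-sixthPowerTrace 0# (- e)) (realised-sixthPowerTrace 0# (- e)))))

  realised-3x² : ∀ x → Realised (n# 3 * x ^ 2)
  realised-3x² x = realised-cong
    (solve 1 (λ x → (natᴾ 9 :* (x :* x) :- natᴾ 6 :* x) :+ (natᴾ 6 :* (x :* x :+ x) :+ :- (natᴾ 12 :* (x :* x)))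
                    := natᴾ 3 :* x ^ᴾ 2) refl x)
    (realised-+ (realised-9d²-6d x) (realised-+ (realised-6[d²+d] x) (realised--12e (x * x))))

  realised-6y : ∀ y → Realised (n# 6 * y)
  realised-6y y = realised-cong
    (solve 1 (λ y → natᴾ 6 :* (y :* y :+ y) :+ ((natᴾ 9 :* (y :* y) :- natᴾ 6 :* y)
                      :+ ((natᴾ 9 :* (:- y :* :- y) :- natᴾ 6 :* :- y) :+ :- (natᴾ 12 :* (natᴾ 2 :* (y :* y)))))
                    := natᴾ 6 :* y) refl y)
    (realised-+ (realised-6[d²+d] y) (realised-+ (realised-9d²-6d y)
      (realised-+ (realised-9d²-6d (- y)) (realised--12e (n# 2 * (y * y))))))

  realised-sForm : ∀ x₀ x₁ x₂ y → Realised (sForm x₀ x₁ x₂ y)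
  realised-sForm x₀ x₁ x₂ y = realised-cong
    (solve 4 (λ x₀ x₁ x₂ y → sixthPowerTraceᴾ x₀ 0ᴾ :+ (sixthPowerTraceᴾ 0ᴾ x₁ :+ (natᴾ 3 :* x₂ ^ᴾ 2 :+ natᴾ 6 :* y))
                             := sFormᴾ x₀ x₁ x₂ y) refl x₀ x₁ x₂ y)
    (realised-+ (realised-sixthPowerTrace x₀ 0#)
      (realised-+ (realised-sixthPowerTrace 0# x₁) (realised-+ (realised-3x² x₂) (realised-6y y))))

  realised⇒sumOfSixthPowers : ∀ M → Realised (tr R M) → SumOfSixthPowers M
  realised⇒sumOfSixthPowers M (B , B∈ , trB≈trM) =
    sumOfSixthPowers-cong M≋B⊕C (sumOfSixthPowers-+ B∈ (traceless-sumOfSixthPowers C trC≈0))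
    where
    C : Matrix
    C i j = M i j - B i j

    M≋B⊕C : M ≋ B ⊕ C
    M≋B⊕C i j = solve 2 (λ m b → m := b :+ (m :- b)) refl (M i j) (B i j)

    trC≈0 : tr R C ≈ 0#
    trC≈0 = begin
      tr R C           ≈⟨ interchange (M zero zero) (- B zero zero) (M (suc zero) (suc zero)) _ ⟩
      tr R M + (- B zero zero - B (suc zero) (suc zero))  ≈⟨ +-congˡ (-‿+-comm _ _) ⟩
      tr R M - tr R B  ≈⟨ +-congˡ (-‿cong trB≈trM) ⟩
      tr R M - tr R M  ≈⟨ -‿inverseʳ _ ⟩
      0#               ∎

theorem3p3 : ∀ {c ℓ} (R : CommutativeRing c ℓ) (M : Mat₂ R) →
    IsSumOfSixthPowers R M ⇔ TraceInS R (tr R M)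
theorem3p3 R M = mk⇔
  (λ (r , f , M≋) → traceInS-cong (+-cong (M≋ zero zero) (M≋ (suc zero) (suc zero))) (traceInS-sumM r f))
  (λ (x₀ , x₁ , x₂ , y , trM≈) → sumOfSixthPowers⇒isSumOfSixthPowers
    (realised⇒sumOfSixthPowers M (realised-cong (sym trM≈) (realised-sForm x₀ x₁ x₂ y))))
  where
  open CommutativeRing R using (+-cong; sym)
  open SixthPowers R
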